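{- Let $h \geq 2$. Let $r_1 < r_2 < \cdots < r_h$ be pairwise relatively prime positive integers, and let $P$ be a positive integer such that $P \geq r_h - r_1$ and such that, whenever $1 \leq i < j \leq h$ and a prime $p$ divides $r_j - r_i$, $p$ divides $P$. Let $k \geq 1$, define $s_{i,k} = kP + r_i$ for $i = 1,\ldots,h$, $S_k = \prod_{i=1}^h s_{i,k}$, and $a_{i,k} = S_k/s_{i,k} = \prod_{j\neq i} s_{j,k}$. If $n$ and $L$ are integers with \[ (h-1)S_k < n \leq L, \] then there exist nonnegative integers $v_1,\ldots,v_h$ such that \[ a_{1,k}v_1 + a_{2,k}v_2 + \cdots + a_{h,k}v_h = n \] and $v_i \leq L / a_{i,k}$ for $i = 1,\ldots,h$. -}

module Defs where

open import Data.Nat using (ℕ; zero; suc; _+_; _*_)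
open import Data.Fin using (Fin; zero; suc; punchIn)

∏ : ∀ {n} → (Fin n → ℕ) → ℕ
∏ {zero} f = 1
∏ {suc n} f = f zero * ∏ (λ j → f (suc j))

∑ : ∀ {n} → (Fin n → ℕ) → ℕ
∑ {zero} f = 0
∑ {suc n} f = f zero + ∑ (λ j → f (suc j))

s : ∀ {h} → (r : Fin h → ℕ) → (P k : ℕ) → Fin h → ℕ
s r P k i = k * P + r i

S : ∀ {h} → (r : Fin h → ℕ) → (P k : ℕ) → ℕ
S r P k = ∏ (s r P k)

-- a_{i,k} = ∏_{j ≠ i} s_{j,k}  (j ranges over the indices ≠ i via punchIn i)
a : ∀ {m} → (r : Fin (suc m) → ℕ) → (P k : ℕ) → Fin (suc m) → ℕ
a r P k i = ∏ (λ j → s r P k (punchIn i j))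

{-# OPTIONS --safe #-}
module Submission where

-- The shifted moduli s i = k P + r i are pairwise coprime: a prime dividing s i and s j divides
-- r j − r i, hence P, hence r i and r j.  For pairwise coprime s 0, …, s m every n > m ∏ s is a
-- nonnegative combination of the cofactors a i = ∏_{j ≠ i} s j.  Indeed a 0 is coprime to s 0, so
-- some v 0 < s 0 has a 0 v 0 ≡ n (mod s 0); then n = a 0 v 0 + q s 0 with q > (m − 1) ∏_{j ≥ 1} s j,
-- and since the other cofactors are s 0 times the cofactors of s 1, …, s m, induction on m
-- represents q.  Each term of the combination is at most n ≤ L.

open import Defs
open import Data.Nat using (ℕ; zero; suc; _+_; _*_; _∸_; _≤_; _<_; _%_; _/_; NonZero; >-nonZero)
open import Data.Nat.Properties
open import Data.Nat.Divisibility using (_∣_; _∤_; divides; ∣-trans; ∣1⇒≡1; 0∣⇒≡0; ∣m+n∣m⇒∣n; n∣m*n)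
open import Data.Nat.DivMod using (m≡m%n+[m/n]*n; m%n<n)
open import Data.Nat.GCD using (module Bézout)
open import Data.Nat.Primality using (Prime; ¬prime[1])
open import Data.Nat.Primality.Factorisation using (factorise)
open import Data.Nat.Coprimality using (Coprime; coprime-Bézout; coprime-divisor)
import Data.Nat.Coprimality as Coprime
open import Data.Nat.ListAction using (product)
open import Data.Nat.Tactic.RingSolver using (solve-∀)
open import Data.Fin using (Fin; fromℕ; suc; punchIn) renaming (zero to fzero; _<_ to _<ᶠ_)
import Data.Fin.Properties as Finₚ
open import Data.List using ([]; _∷_)
open import Data.List.Relation.Unary.All using (_∷_)
open import Data.Product using (Σ; _×_; _,_; ∃; ∃₂; proj₁; proj₂)
open import Function using (_∘_)
open import Relation.Binary using (tri<; tri≈; tri>)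
open import Relation.Nullary using (contradiction)
open import Relation.Binary.PropositionalEquality using (_≡_; _≢_; sym; trans; cong; cong₂; subst; module ≡-Reasoning)

term≤∑ : ∀ {n} (f : Fin n → ℕ) i → f i ≤ ∑ f
term≤∑ f fzero   = m≤m+n _ _
term≤∑ f (suc i) = ≤-trans (term≤∑ (f ∘ suc) i) (m≤n+m _ _)

∑-factorˡ : ∀ {n} c (f g : Fin n → ℕ) → ∑ (λ j → (c * f j) * g j) ≡ c * ∑ (λ j → f j * g j)
∑-factorˡ {zero}  c f g = sym (*-zeroʳ c)
∑-factorˡ {suc n} c f g = begin
  c * f fzero * g fzero + ∑ (λ j → c * f (suc j) * g (suc j))
    ≡⟨ cong₂ _+_ (*-assoc c (f fzero) (g fzero)) (∑-factorˡ c (f ∘ suc) (g ∘ suc)) ⟩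
  c * (f fzero * g fzero) + c * ∑ (λ j → f (suc j) * g (suc j))
    ≡⟨ sym (*-distribˡ-+ c _ _) ⟩
  c * ∑ (λ j → f j * g j) ∎
  where open ≡-Reasoning

∏-coprime : ∀ {n} (t : Fin n → ℕ) {c} → (∀ j → Coprime (t j) c) → Coprime (∏ t) c
∏-coprime {zero}  t _   (d∣1 , _) = ∣1⇒≡1 d∣1
∏-coprime {suc n} t tc  (d∣∏ , d∣c) = ∏-coprime (t ∘ suc) (tc ∘ suc) (coprime-divisor d⊥t₀ d∣∏ , d∣c)
  where
  d⊥t₀ : Coprime _ (t fzero)
  d⊥t₀ (e∣d , e∣t₀) = tc fzero (e∣t₀ , ∣-trans e∣d d∣c)

no-prime-divisor⇒≡1 : ∀ d .{{_ : NonZero d}} → (∀ {p} → Prime p → p ∤ d) → d ≡ 1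
no-prime-divisor⇒≡1 d p∤d with factorise d
... | record { factors = [] ; isFactorisation = d≡1 } = d≡1
... | record { factors = p ∷ ps ; isFactorisation = d≡p*∏ps ; factorsPrime = p-prime ∷ _ } =
  contradiction (divides (product ps) (trans d≡p*∏ps (*-comm p _))) (p∤d p-prime)

shift-coprime : ∀ c {x y} → x < y → Coprime x y → (∀ {p} → Prime p → p ∣ y ∸ x → p ∣ c) →
                Coprime (c + x) (c + y)
shift-coprime c {x} {y} x<y x⊥y primes∣c {zero} (_ , 0∣c+y) =
  contradiction (0∣⇒≡0 0∣c+y) (m<n⇒n≢0 (≤-trans x<y (m≤n+m y c)))
shift-coprime c {x} {y} x<y x⊥y primes∣c {d@(suc _)} (d∣c+x , d∣c+y) = no-prime-divisor⇒≡1 d p∤d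
  where
  c+y≡c+x+[y∸x] : c + y ≡ c + x + (y ∸ x)
  c+y≡c+x+[y∸x] = trans (cong (c +_) (sym (m+[n∸m]≡n (<⇒≤ x<y)))) (sym (+-assoc c x _))
  p∤d : ∀ {p} → Prime p → p ∤ d
  p∤d {p} p-prime p∣d = ¬prime[1] (subst Prime (x⊥y (p∣x , p∣y)) p-prime)
    where
    p∣c+x = ∣-trans p∣d d∣c+x
    p∣c+y = ∣-trans p∣d d∣c+y
    p∣c = primes∣c p-prime (∣m+n∣m⇒∣n (subst (p ∣_) c+y≡c+x+[y∸x] p∣c+y) p∣c+x)
    p∣x = ∣m+n∣m⇒∣n p∣c+x p∣c
    p∣y = ∣m+n∣m⇒∣n p∣c+y p∣c

infix 4 _≡_mod_
_≡_mod_ : ℕ → ℕ → ℕ → Set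
x ≡ y mod s = ∃₂ λ X Y → x + X * s ≡ y + Y * s

coprime⇒*-solvable : ∀ {A s} .{{_ : NonZero s}} → Coprime A s → ∀ n → ∃ λ w → A * w ≡ n mod s
coprime⇒*-solvable {A} {suc c} A⊥s n with coprime-Bézout A⊥s
... | Bézout.+- x y 1+ys≡xA = x * n , 0 , y * n , (begin
  A * (x * n) + 0 * suc c  ≡⟨ lhs A x n (suc c) ⟩
  (x * A) * n              ≡⟨ cong (_* n) (sym 1+ys≡xA) ⟩
  (1 + y * suc c) * n      ≡⟨ rhs y n (suc c) ⟩
  n + (y * n) * suc c      ∎)
  where
  open ≡-Reasoning
  lhs : ∀ A x n s → A * (x * n) + 0 * s ≡ (x * A) * n
  lhs = solve-∀
  rhs : ∀ y n s → (1 + y * s) * n ≡ n + (y * n) * s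
  rhs = solve-∀
-- x A ≡ −1 and c ≡ −1 (mod c + 1), so x n c is a solution.
... | Bézout.-+ x y 1+xA≡ys = x * n * c , n , y * n * c , (begin
  A * (x * n * c) + n * suc c  ≡⟨ lhs A x n c ⟩
  (1 + x * A) * (n * c) + n    ≡⟨ cong (λ z → z * (n * c) + n) 1+xA≡ys ⟩
  (y * suc c) * (n * c) + n    ≡⟨ rhs y n c ⟩
  n + (y * n * c) * suc c      ∎)
  where
  open ≡-Reasoning
  lhs : ∀ A x n c → A * (x * n * c) + n * suc c ≡ (1 + x * A) * (n * c) + n
  lhs = solve-∀
  rhs : ∀ y n c → (y * suc c) * (n * c) + n ≡ n + (y * n * c) * suc c
  rhs = solve-∀

+*-≡mod : ∀ {x n s} z → x + z * s ≡ n mod s → x ≡ n mod s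
+*-≡mod {x} {n} {s} z (X , Y , eq) = z + X , Y , (begin
  x + (z + X) * s      ≡⟨ cong (x +_) (*-distribʳ-+ s z X) ⟩
  x + (z * s + X * s)  ≡⟨ sym (+-assoc x _ _) ⟩
  x + z * s + X * s    ≡⟨ eq ⟩
  n + Y * s            ∎)
  where open ≡-Reasoning

*-%-≡mod : ∀ A w {n s} .{{_ : NonZero s}} → A * w ≡ n mod s → A * (w % s) ≡ n mod s
*-%-≡mod A w {n} {s} = +*-≡mod (A * (w / s)) ∘ subst (_≡ n mod s) Aw≡
  where
  open ≡-Reasoning
  Aw≡ : A * w ≡ A * (w % s) + A * (w / s) * s
  Aw≡ = begin
    A * w                        ≡⟨ cong (A *_) (m≡m%n+[m/n]*n w s) ⟩
    A * (w % s + w / s * s)      ≡⟨ *-distribˡ-+ A (w % s) _ ⟩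
    A * (w % s) + A * (w / s * s) ≡⟨ cong (A * (w % s) +_) (sym (*-assoc A (w / s) s)) ⟩
    A * (w % s) + A * (w / s) * s ∎

≡mod∧≤⇒+* : ∀ {x n s} → x ≡ n mod s → x ≤ n → ∃ λ q → x + q * s ≡ n
≡mod∧≤⇒+* {x} {n} {s} (X , Y , eq) x≤n = X ∸ Y , (begin
  x + (X ∸ Y) * s      ≡⟨ cong (x +_) (*-distribʳ-∸ s X Y) ⟩
  x + (X * s ∸ Y * s)  ≡⟨ sym (+-∸-assoc x Ys≤Xs) ⟩
  x + X * s ∸ Y * s    ≡⟨ cong (_∸ Y * s) eq ⟩
  n + Y * s ∸ Y * s    ≡⟨ m+n∸n≡m n (Y * s) ⟩
  n                    ∎)
  where
  open ≡-Reasoning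
  Ys≤Xs : Y * s ≤ X * s
  Ys≤Xs = ≮⇒≥ λ Xs<Ys → <-irrefl eq (+-mono-≤-< x≤n Xs<Ys)

division-step : ∀ A s .{{_ : NonZero s}} → Coprime A s → ∀ n → A * s ≤ n →
                ∃₂ λ v q → v < s × A * v + q * s ≡ n
division-step A s A⊥s n As≤n with coprime⇒*-solvable A⊥s n
... | w , Aw≡n with ≡mod∧≤⇒+* (*-%-≡mod A w Aw≡n) (≤-trans (*-monoʳ-≤ A (<⇒≤ (m%n<n w s))) As≤n)
... | q , Av+qs≡n = w % s , q , m%n<n w s , Av+qs≡n

cofactor : ∀ {m} → (Fin (suc m) → ℕ) → Fin (suc m) → ℕ
cofactor s i = ∏ (s ∘ punchIn i)

CofactorCombination : ∀ {m} → (Fin (suc m) → ℕ) → ℕ → Set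
CofactorCombination s n = Σ (Fin _ → ℕ) λ v → ∑ (λ i → cofactor s i * v i) ≡ n

cofactor-combination : ∀ {m} (s : Fin (suc m) → ℕ) → (∀ i → 0 < s i) →
                       (∀ i j → i ≢ j → Coprime (s i) (s j)) →
                       ∀ n → m * ∏ s < n → CofactorCombination s n
cofactor-combination {zero}  s _   _         n _ = (λ _ → n) , trans (+-identityʳ _) (+-identityʳ n)
cofactor-combination {suc m} s s>0 s-coprime n m∏s<n =
  extend (division-step A s₀ {{>-nonZero (s>0 fzero)}} A⊥s₀ n As₀≤n)
  where
  s₀ : ℕ
  s₀ = s fzero
  t : Fin (suc m) → ℕ
  t = s ∘ suc
  A : ℕ
  A = ∏ t
  A⊥s₀ : Coprime A s₀
  A⊥s₀ = ∏-coprime t (λ j → s-coprime (suc j) fzero λ ())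
  As₀≤n : A * s₀ ≤ n
  As₀≤n = ≤-trans (≤-trans (≤-reflexive (*-comm A s₀)) (m≤m+n (s₀ * A) _)) (<⇒≤ m∏s<n)
  extend : (∃₂ λ v₀ q → v₀ < s₀ × A * v₀ + q * s₀ ≡ n) → CofactorCombination s n
  extend (v₀ , q , v₀<s₀ , Av₀+qs₀≡n) = (λ { fzero → v₀ ; (suc j) → v′ j }) , ∑≡n
    where
    mAs₀<qs₀ : m * A * s₀ < q * s₀
    mAs₀<qs₀ = +-cancelˡ-< (A * v₀) _ _ (begin-strict
      A * v₀ + m * A * s₀    ≤⟨ +-mono-≤ (≤-trans (*-monoʳ-≤ A (<⇒≤ v₀<s₀)) (≤-reflexive (*-comm A s₀)))
                                         (≤-reflexive (trans (*-assoc m A s₀) (cong (m *_) (*-comm A s₀)))) ⟩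
      s₀ * A + m * (s₀ * A)  <⟨ m∏s<n ⟩
      n                      ≡⟨ Av₀+qs₀≡n ⟨
      A * v₀ + q * s₀        ∎)
      where open ≤-Reasoning
    tail-combination : CofactorCombination t q
    tail-combination = cofactor-combination t (s>0 ∘ suc)
      (λ i j i≢j → s-coprime (suc i) (suc j) (i≢j ∘ Finₚ.suc-injective))
      q (*-cancelʳ-< s₀ (m * A) q mAs₀<qs₀)
    v′ : Fin (suc m) → ℕ
    v′ = proj₁ tail-combination
    ∑≡q : ∑ (λ j → cofactor t j * v′ j) ≡ q
    ∑≡q = proj₂ tail-combination
    ∑≡n : A * v₀ + ∑ (λ j → (s₀ * cofactor t j) * v′ j) ≡ n
    ∑≡n = begin
      A * v₀ + ∑ (λ j → (s₀ * cofactor t j) * v′ j)  ≡⟨ cong (A * v₀ +_) (∑-factorˡ s₀ (cofactor t) v′) ⟩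
      A * v₀ + s₀ * ∑ (λ j → cofactor t j * v′ j)    ≡⟨ cong (λ x → A * v₀ + s₀ * x) ∑≡q ⟩
      A * v₀ + s₀ * q                                ≡⟨ cong (A * v₀ +_) (*-comm s₀ q) ⟩
      A * v₀ + q * s₀                                ≡⟨ Av₀+qs₀≡n ⟩
      n                                              ∎
      where open ≡-Reasoning

lemma3 : (m : ℕ) → 2 ≤ suc m →
         (r : Fin (suc m) → ℕ) →
         (∀ i j → i <ᶠ j → r i < r j) →
         (∀ i → 1 ≤ r i) →
         (∀ i j → i ≢ j → Coprime (r i) (r j)) →
         (P : ℕ) → 1 ≤ P →
         r (fromℕ m) ∸ r fzero ≤ P →
         (∀ i j → i <ᶠ j → (p : ℕ) → Prime p → p ∣ (r j ∸ r i) → p ∣ P) →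
         (k : ℕ) → 1 ≤ k →
         (n L : ℕ) → m * S r P k < n → n ≤ L →
         Σ (Fin (suc m) → ℕ) λ v →
           (∑ (λ i → a r P k i * v i) ≡ n) × (∀ i → a r P k i * v i ≤ L)
lemma3 m _ r r-increasing r-positive r-coprime P _ _ primes∣P k _ n L m∏s<n n≤L =
  v , ∑≡n , λ i → ≤-trans (term≤∑ (λ j → a r P k j * v j) i) (subst (_≤ L) (sym ∑≡n) n≤L)
  where
  s-coprime< : ∀ i j → i <ᶠ j → Coprime (s r P k i) (s r P k j)
  s-coprime< i j i<j = shift-coprime (k * P) (r-increasing i j i<j) (r-coprime i j (Finₚ.<⇒≢ i<j))
                         λ {p} p-prime p∣rⱼ-rᵢ → ∣-trans (primes∣P i j i<j p p-prime p∣rⱼ-rᵢ) (n∣m*n k)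
  s-coprime : ∀ i j → i ≢ j → Coprime (s r P k i) (s r P k j)
  s-coprime i j i≢j with Finₚ.<-cmp i j
  ... | tri< i<j _ _ = s-coprime< i j i<j
  ... | tri≈ _ i≡j _ = contradiction i≡j i≢j
  ... | tri> _ _ j<i = Coprime.sym (s-coprime< j i j<i)
  combination : CofactorCombination (s r P k) n
  combination = cofactor-combination (s r P k) (λ i → ≤-trans (r-positive i) (m≤n+m (r i) (k * P)))
                  s-coprime n m∏s<n
  v : Fin (suc m) → ℕ
  v = proj₁ combination
  ∑≡n : ∑ (λ i → a r P k i * v i) ≡ n
  ∑≡n = proj₂ combination
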